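{- Every selector-free first-order formula over a (co)datatype signature can be effectively transformed into a formula over the corresponding tree signature (same sorts, the constructors as generators, and predicates $\mathrm{fin}_s$) that is equisatisfiable with it, where satisfiability of the former is with respect to structures of (co)datatypes and of the latter with respect to the structure $\mathcal T$ of trees (extended theory of trees).
   Context: A (co)datatype signature: sorts partitioned into datatypes and codatatypes; each (co)datatype has at least one constructor $C:\delta_1\times\cdots\times\delta_n\to\delta$ (with associated selectors); constructor arguments of datatypes are datatypes, of codatatypes are codatatypes; every datatype has a ground constructor term. A structure of (co)datatypes interprets each codatatype as the set of all (finite or infinite) constructor trees of that sort, each datatype as the set of finite constructor trees of that sort, and constructors as tree-building operations (a constructor tree of sort $\delta$ is a rooted ordered possibly infinite tree whose root is labeled by a constructor $C:\delta_1\times\cdots\times\delta_n\to\delta$ and whose children in order are constructor trees of sorts $\delta_1,\dots,\delta_n$). The structure $\mathcal T$ of trees for a many-sorted signature with sorts $S$, generators $f: s_1\times\cdots\times s_n\to s$ and predicates $\mathrm{fin}_s$ ($s\in S$) interprets each sort $s$ as the set of all (finite or infinite) trees of sort $s$ (defined as constructor trees above, labeled by generators), each generator as the corresponding tree-building function, and $\mathrm{fin}_s$ as the set of finite trees of sort $s$. The extended theory of trees is the set of sentences true in $\mathcal T$. -}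

module Defs where

open import Data.Bool using (Bool; true; false)
open import Data.Nat using (ℕ; zero; suc)
open import Data.List using (List; []; _∷_)
open import Data.List.Membership.Propositional using (_∈_)
open import Data.List.Relation.Unary.All using (All; []; _∷_; lookup)
import Data.List.Relation.Unary.All as All
open import Data.Product using (Σ; ∃; _×_; _,_; proj₁; proj₂)
open import Data.Sum using (_⊎_; inj₁; inj₂)
open import Data.Empty using (⊥)
open import Data.Unit using (⊤)
open import Level using (Lift)
open import Relation.Binary.PropositionalEquality using (_≡_; refl)
open import Relation.Nullary using (¬_)
open import Function.Bundles using (_⇔_)

-- The same data is read as a (co)datatype signature (constructors) or as
-- the corresponding tree signature (constructors as generators, plus
-- predicates fin_s).

record Sig : Set₁ where
  field
    Sort  : Set
    isCo  : Sort → Bool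
    Con   : Sort → Set
    arity : {s : Sort} → Con s → List Sort

module _ (S : Sig) where
  open Sig S

  -- Since coinductive records (--guardedness) are not available, a tree
  -- of sort s is presented as a state of a sorted coalgebra: from each
  -- state we can read off its root constructor and the states of its
  -- children.  The tree is the (possibly infinite) unfolding of the root
  -- state; equality of trees is equality of all finite-depth truncations
  -- of the unfoldings (see _≈T_), so only the unfolded tree matters.

  Node : (Sort → Set) → Sort → Set
  Node X s = Σ (Con s) (λ c → All X (arity c))

  record Tree (s : Sort) : Set₁ where
    field
      St   : Sort → Set
      step : {s' : Sort} → St s' → Node St s'
      root : St s

  data Trunc (s : Sort) : Set where
    ⋆    : Trunc s
    node : (c : Con s) → All Trunc (arity c) → Trunc s

  module _ {X : Sort → Set} (step : {s : Sort} → X s → Node X s) where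
    mutual
      approxSt : {s : Sort} → ℕ → X s → Trunc s
      approxSt zero    x = ⋆
      approxSt (suc n) x = node (proj₁ (step x)) (approxAll n (proj₂ (step x)))

      approxAll : {Δ : List Sort} → ℕ → All X Δ → All Trunc Δ
      approxAll n []       = []
      approxAll n (x ∷ xs) = approxSt n x ∷ approxAll n xs

    mutual
      data FiniteSt {s : Sort} (x : X s) : Set where
        fin : FiniteAll (proj₂ (step x)) → FiniteSt x

      data FiniteAll : {Δ : List Sort} → All X Δ → Set where
        []  : FiniteAll []
        _∷_ : {s : Sort} {Δ : List Sort} {x : X s} {xs : All X Δ} →
              FiniteSt x → FiniteAll xs → FiniteAll (x ∷ xs)

  approx : {s : Sort} → ℕ → Tree s → Trunc s
  approx n t = approxSt (Tree.step t) n (Tree.root t)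

  _≈T_ : {s : Sort} → Tree s → Tree s → Set
  t ≈T u = (n : ℕ) → approx n t ≡ approx n u

  Finite : {s : Sort} → Tree s → Set
  Finite t = FiniteSt (Tree.step t) (Tree.root t)

  InArgs : {Δ : List Sort} → All Tree Δ → Sort → Set
  InArgs []       s' = ⊥
  InArgs (t ∷ ts) s' = Tree.St t s' ⊎ InArgs ts s'

  rootsIn : {Δ : List Sort} (ts : All Tree Δ) → All (InArgs ts) Δ
  rootsIn []       = []
  rootsIn (t ∷ ts) = inj₁ (Tree.root t) ∷ All.map inj₂ (rootsIn ts)

  stepIn : {Δ : List Sort} (ts : All Tree Δ) {s' : Sort} →
           InArgs ts s' → Node (InArgs ts) s'
  stepIn (t ∷ ts) (inj₁ x) = proj₁ (Tree.step t x) , All.map inj₁ (proj₂ (Tree.step t x))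
  stepIn (t ∷ ts) (inj₂ p) = proj₁ (stepIn ts p) , All.map inj₂ (proj₂ (stepIn ts p))

  build : {s : Sort} (c : Con s) → All Tree (arity c) → Tree s
  build {s} c ts = record { St = St' ; step = step' ; root = inj₁ refl }
    where
      St' : Sort → Set
      St' s' = s' ≡ s ⊎ InArgs ts s'
      step' : {s' : Sort} → St' s' → Node St' s'
      step' (inj₁ refl) = c , All.map inj₂ (rootsIn ts)
      step' (inj₂ p)    = proj₁ (stepIn ts p) , All.map inj₂ (proj₂ (stepIn ts p))

  record WellFormed : Set₁ where
    field
      hasCon     : (s : Sort) → Con s
      dataArgs   : (s : Sort) (c : Con s) → isCo s ≡ false →
                   All (λ s' → isCo s' ≡ false) (arity c)
      codataArgs : (s : Sort) (c : Con s) → isCo s ≡ true →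
                   All (λ s' → isCo s' ≡ true) (arity c)
      groundTerm : (s : Sort) → isCo s ≡ false → Σ (Tree s) Finite

  -- Atomic predicates are given by a family P: for the (co)datatype
  -- signature P = λ _ → ⊥ (only equality), for the tree signature
  -- P = λ _ → ⊤ (one predicate fin_s per sort s).

  Ctx : Set
  Ctx = List Sort

  data Term (Γ : Ctx) : Sort → Set where
    var : {s : Sort} → s ∈ Γ → Term Γ s
    app : {s : Sort} (c : Con s) → All (Term Γ) (arity c) → Term Γ s

  data Form (P : Sort → Set) (Γ : Ctx) : Set where
    tt ff    : Form P Γ
    _≐_      : {s : Sort} → Term Γ s → Term Γ s → Form P Γ
    pred     : {s : Sort} → P s → Term Γ s → Form P Γ
    ~_       : Form P Γ → Form P Γ
    _∧_ _∨_ _⇒_ : Form P Γ → Form P Γ → Form P Γ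
    all ex   : (s : Sort) → Form P (s ∷ Γ) → Form P Γ

  DtForm : Ctx → Set
  DtForm = Form (λ _ → ⊥)

  TreeForm : Ctx → Set
  TreeForm = Form (λ _ → ⊤)

  -- Both structures have tree-building constructors; the
  -- structure of trees T has domain all trees of sort s, the structure of
  -- (co)datatypes has domain: all trees for codatatypes, finite trees for
  -- datatypes.

  module Semantics (Dom : Sort → Set₁) (val : {s : Sort} → Dom s → Tree s)
                   (Pred : {s : Sort} → Tree s → Set) where
    Env : Ctx → Set₁
    Env Γ = All Dom Γ

    mutual
      evalT : {Γ : Ctx} {s : Sort} → Env Γ → Term Γ s → Tree s
      evalT ρ (var x)    = val (lookup ρ x)
      evalT ρ (app c ts) = build c (evalAll ρ ts)

      evalAll : {Γ : Ctx} {Δ : List Sort} → Env Γ → All (Term Γ) Δ → All Tree Δ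
      evalAll ρ []       = []
      evalAll ρ (t ∷ ts) = evalT ρ t ∷ evalAll ρ ts

    ⟦_⟧ : {P : Sort → Set} {Γ : Ctx} → Form P Γ → Env Γ → Set₁
    ⟦ tt ⟧      ρ = Lift _ ⊤
    ⟦ ff ⟧      ρ = Lift _ ⊥
    ⟦ t ≐ u ⟧   ρ = Lift _ (evalT ρ t ≈T evalT ρ u)
    ⟦ pred _ t ⟧ ρ = Lift _ (Pred (evalT ρ t))
    ⟦ ~ φ ⟧     ρ = ¬ ⟦ φ ⟧ ρ
    ⟦ φ ∧ ψ ⟧   ρ = ⟦ φ ⟧ ρ × ⟦ ψ ⟧ ρ
    ⟦ φ ∨ ψ ⟧   ρ = ⟦ φ ⟧ ρ ⊎ ⟦ ψ ⟧ ρ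
    ⟦ φ ⇒ ψ ⟧   ρ = ⟦ φ ⟧ ρ → ⟦ ψ ⟧ ρ
    ⟦ all s φ ⟧ ρ = (d : Dom s) → ⟦ φ ⟧ (d ∷ ρ)
    ⟦ ex s φ ⟧  ρ = Σ (Dom s) (λ d → ⟦ φ ⟧ (d ∷ ρ))

    Satisfiable : {P : Sort → Set} {Γ : Ctx} → Form P Γ → Set₁
    Satisfiable {Γ = Γ} φ = Σ (Env Γ) (λ ρ → ⟦ φ ⟧ ρ)

  DtDom : Sort → Set₁
  DtDom s = Σ (Tree s) (λ t → isCo s ≡ true ⊎ Finite t)

  DtSatisfiable : {Γ : Ctx} → DtForm Γ → Set₁
  DtSatisfiable = Semantics.Satisfiable DtDom proj₁ (λ _ → ⊥)

  TreeSatisfiable : {Γ : Ctx} → TreeForm Γ → Set₁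
  TreeSatisfiable = Semantics.Satisfiable Tree (λ t → t) Finite

-- A variable of a datatype sort ranges over the finite trees of that sort,
-- and a variable of a codatatype sort over all trees, which is exactly its
-- range in the structure of trees.  So relativizing every datatype
-- quantifier to fin_s turns truth in the (co)datatype structure into truth
-- in T, and closing the free variables existentially in the same
-- relativized way turns satisfiability into satisfiability.
module Submission where

open import Defs
open import Data.Bool using (true; false)
open import Data.Empty using (⊥)
open import Data.List using (List; []; _∷_)
open import Data.List.Relation.Unary.All using (All; []; _∷_)
import Data.List.Relation.Unary.All as All
open import Data.List.Relation.Unary.All.Properties using (lookup-map)
open import Data.List.Relation.Unary.Any using (here)
open import Data.Product using (Σ; _,_; proj₁)
open import Data.Product.Function.NonDependent.Propositional using (_×-⇔_)
open import Data.Product.Function.Dependent.Propositional using (congˡ)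
open import Data.Sum using (_⊎_; inj₁; inj₂)
open import Data.Sum.Function.Propositional using (_⊎-⇔_)
open import Data.Unit using (tt)
open import Function.Base using (id)
open import Function.Bundles using (_⇔_; mk⇔; Equivalence)
open import Function.Construct.Composition using (_⇔-∘_)
open import Function.Construct.Symmetry using (⇔-sym)
open import Function.Related.TypeIsomorphisms using (→-cong-⇔; ¬-cong-⇔)
open import Level using (Level; lift; lower)
open import Relation.Binary.PropositionalEquality using (_≡_; refl; sym; cong; cong₂)

open Equivalence using (to; from)

Π-cong-⇔ : {a b c : Level} {A : Set a} {B : A → Set b} {C : A → Set c} →
           ((x : A) → B x ⇔ C x) → ((x : A) → B x) ⇔ ((x : A) → C x)
Π-cong-⇔ B⇔C = mk⇔ (λ f x → to (B⇔C x) (f x)) (λ g x → from (B⇔C x) (g x))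

module _ (S : Sig) where
  open Sig S

  private
    module D = Semantics S (DtDom S) proj₁ (λ _ → ⊥)
    module T = Semantics S (Tree S) id (Finite S)

  module _ {Dom : Sort → Set₁} (val : {s : Sort} → Dom s → Tree S s)
           (Pred : {s : Sort} → Tree S s → Set) where
    private
      module V = Semantics S Dom val Pred

    mutual
      evalT-map : {Γ : Ctx S} {s : Sort} (ρ : All Dom Γ) (t : Term S Γ s) →
                  V.evalT ρ t ≡ T.evalT (All.map val ρ) t
      evalT-map ρ (var x)    = sym (lookup-map ρ x)
      evalT-map ρ (app c ts) = cong (build S c) (evalAll-map ρ ts)

      evalAll-map : {Γ : Ctx S} {Δ : List Sort} (ρ : All Dom Γ) (ts : All (Term S Γ) Δ) →
                    V.evalAll ρ ts ≡ T.evalAll (All.map val ρ) ts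
      evalAll-map ρ []       = refl
      evalAll-map ρ (t ∷ ts) = cong₂ _∷_ (evalT-map ρ t) (evalAll-map ρ ts)

  forget : {Γ : Ctx S} → All (DtDom S) Γ → All (Tree S) Γ
  forget = All.map proj₁

  inDtDom : {Γ : Ctx S} (s : Sort) → TreeForm S (s ∷ Γ)
  inDtDom s with isCo s
  ... | true  = tt
  ... | false = pred tt (var (here refl))

  ⟦inDtDom⟧⇔ : {Γ : Ctx S} (s : Sort) (t : Tree S s) (σ : All (Tree S) Γ) →
               T.⟦ inDtDom s ⟧ (t ∷ σ) ⇔ (isCo s ≡ true ⊎ Finite S t)
  ⟦inDtDom⟧⇔ s t σ with isCo s
  ... | true  = mk⇔ (λ _ → inj₁ refl) (λ _ → lift tt)
  ... | false = mk⇔ (λ t-fin → inj₂ (lower t-fin)) (λ { (inj₁ ()) ; (inj₂ t-fin) → lift t-fin })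

  exDt allDt : {Γ : Ctx S} (s : Sort) → TreeForm S (s ∷ Γ) → TreeForm S Γ
  exDt  s ψ = ex  s (inDtDom s ∧ ψ)
  allDt s ψ = all s (inDtDom s ⇒ ψ)

  ⟦exDt⟧⇔ : {Γ : Ctx S} (s : Sort) (ψ : TreeForm S (s ∷ Γ)) (σ : All (Tree S) Γ) →
            T.⟦ exDt s ψ ⟧ σ ⇔ Σ (DtDom S s) (λ d → T.⟦ ψ ⟧ (proj₁ d ∷ σ))
  ⟦exDt⟧⇔ s ψ σ = mk⇔
    (λ { (t , t∈ , p) → (t , to (⟦inDtDom⟧⇔ s t σ) t∈) , p })
    (λ { ((t , t∈) , p) → t , from (⟦inDtDom⟧⇔ s t σ) t∈ , p })

  ⟦allDt⟧⇔ : {Γ : Ctx S} (s : Sort) (ψ : TreeForm S (s ∷ Γ)) (σ : All (Tree S) Γ) →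
             T.⟦ allDt s ψ ⟧ σ ⇔ ((d : DtDom S s) → T.⟦ ψ ⟧ (proj₁ d ∷ σ))
  ⟦allDt⟧⇔ s ψ σ = mk⇔
    (λ h → λ { (t , t∈) → h t (from (⟦inDtDom⟧⇔ s t σ) t∈) })
    (λ h t t∈ → h (t , to (⟦inDtDom⟧⇔ s t σ) t∈))

  relativize : {Γ : Ctx S} → DtForm S Γ → TreeForm S Γ
  relativize tt          = tt
  relativize ff          = ff
  relativize (t ≐ u)     = t ≐ u
  relativize (pred () t)
  relativize (~ φ)       = ~ relativize φ
  relativize (φ ∧ ψ)     = relativize φ ∧ relativize ψ
  relativize (φ ∨ ψ)     = relativize φ ∨ relativize ψ
  relativize (φ ⇒ ψ)     = relativize φ ⇒ relativize ψ
  relativize (all s φ)   = allDt s (relativize φ)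
  relativize (ex s φ)    = exDt s (relativize φ)

  ⟦relativize⟧⇔ : {Γ : Ctx S} (φ : DtForm S Γ) (ρ : All (DtDom S) Γ) →
                  D.⟦ φ ⟧ ρ ⇔ T.⟦ relativize φ ⟧ (forget ρ)
  ⟦relativize⟧⇔ tt ρ = mk⇔ id id
  ⟦relativize⟧⇔ ff ρ = mk⇔ id id
  ⟦relativize⟧⇔ (t ≐ u) ρ
    rewrite evalT-map proj₁ (λ _ → ⊥) ρ t | evalT-map proj₁ (λ _ → ⊥) ρ u = mk⇔ id id
  ⟦relativize⟧⇔ (pred () t) ρ
  ⟦relativize⟧⇔ (~ φ)   ρ = ¬-cong-⇔ (⟦relativize⟧⇔ φ ρ)
  ⟦relativize⟧⇔ (φ ∧ ψ) ρ = ⟦relativize⟧⇔ φ ρ ×-⇔ ⟦relativize⟧⇔ ψ ρ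
  ⟦relativize⟧⇔ (φ ∨ ψ) ρ = ⟦relativize⟧⇔ φ ρ ⊎-⇔ ⟦relativize⟧⇔ ψ ρ
  ⟦relativize⟧⇔ (φ ⇒ ψ) ρ = →-cong-⇔ (⟦relativize⟧⇔ φ ρ) (⟦relativize⟧⇔ ψ ρ)
  ⟦relativize⟧⇔ (all s φ) ρ =
    ⇔-sym (⟦allDt⟧⇔ s (relativize φ) (forget ρ)) ⇔-∘ Π-cong-⇔ (λ d → ⟦relativize⟧⇔ φ (d ∷ ρ))
  ⟦relativize⟧⇔ (ex s φ) ρ =
    ⇔-sym (⟦exDt⟧⇔ s (relativize φ) (forget ρ)) ⇔-∘ congˡ (λ {d} → ⟦relativize⟧⇔ φ (d ∷ ρ))

  exDtClosure : (Γ : Ctx S) → TreeForm S Γ → TreeForm S []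
  exDtClosure []      ψ = ψ
  exDtClosure (s ∷ Γ) ψ = exDtClosure Γ (exDt s ψ)

  ⟦exDtClosure⟧⇔ : (Γ : Ctx S) (ψ : TreeForm S Γ) →
                   T.⟦ exDtClosure Γ ψ ⟧ [] ⇔ Σ (All (DtDom S) Γ) (λ ρ → T.⟦ ψ ⟧ (forget ρ))
  ⟦exDtClosure⟧⇔ []      ψ = mk⇔ (λ p → [] , p) (λ { ([] , p) → p })
  ⟦exDtClosure⟧⇔ (s ∷ Γ) ψ = mk⇔
    (λ p → let ρ , q = to (⟦exDtClosure⟧⇔ Γ (exDt s ψ)) p
               d , r = to (⟦exDt⟧⇔ s ψ (forget ρ)) q
           in d ∷ ρ , r)
    (λ { (d ∷ ρ , r) → from (⟦exDtClosure⟧⇔ Γ (exDt s ψ)) (ρ , from (⟦exDt⟧⇔ s ψ (forget ρ)) (d , r)) })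

  translate : {Γ : Ctx S} → DtForm S Γ → TreeForm S []
  translate {Γ} φ = exDtClosure Γ (relativize φ)

  translate-equisatisfiable : {Γ : Ctx S} (φ : DtForm S Γ) →
                              DtSatisfiable S φ ⇔ TreeSatisfiable S (translate φ)
  translate-equisatisfiable {Γ} φ = mk⇔
    (λ { (ρ , p) → [] , from (⟦exDtClosure⟧⇔ Γ (relativize φ)) (ρ , to (⟦relativize⟧⇔ φ ρ) p) })
    (λ { ([] , p) → let ρ , q = to (⟦exDtClosure⟧⇔ Γ (relativize φ)) p
                    in ρ , from (⟦relativize⟧⇔ φ ρ) q })

-- The translation is faithful for every signature.
theorem4 : (S : Sig) → WellFormed S →
    Σ ({Γ : Ctx S} → DtForm S Γ → Σ (Ctx S) (TreeForm S))
    (λ tr → {Γ : Ctx S} (φ : DtForm S Γ) →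
    DtSatisfiable S φ ⇔ TreeSatisfiable S (Σ.proj₂ (tr φ)))
theorem4 S _ = (λ φ → [] , translate S φ) , translate-equisatisfiable S
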